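{- Let $\langle\mathcal G_n:n\in N\rangle$ be a sequence in $\beta N$ with $\mathcal G_{n+1}\,\widetilde{\mid}\,\mathcal G_n$ for all $n$. (a) For every nonprincipal ultrafilter $\mathcal F$, $\left(\lim_{n\to\mathcal F}\mathcal G_n\right)\cap\mathcal U=\bigcap_{n\in N}(\mathcal G_n\cap\mathcal U)$. (b) For any two nonprincipal ultrafilters $\mathcal F_1,\mathcal F_2$, $\lim_{n\to\mathcal F_1}\mathcal G_n=_\sim\lim_{n\to\mathcal F_2}\mathcal G_n$. (c) Let $\mathcal G=\lim_{n\to\mathcal F}\mathcal G_n$ for some nonprincipal $\mathcal F$. If $\mathcal W\in\beta N$ satisfies $\mathcal W\,\widetilde{\mid}\,\mathcal G_n$ for all $n\in N$, then $\mathcal W\,\widetilde{\mid}\,\mathcal G$.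
   Context: $N=\{0,1,2,\dots\}$, $\beta N$ the set of ultrafilters on $N$. For $A\subseteq N$, $A{\uparrow}=\{n\in N:\exists a\in A\ a\mid n\}$, and $\mathcal U=\{A\subseteq N:A{\uparrow}=A\}$. $\mathcal F\,\widetilde{\mid}\,\mathcal G$ iff $\mathcal F\cap\mathcal U\subseteq\mathcal G$; $\mathcal F=_\sim\mathcal G$ iff $\mathcal F\,\widetilde{\mid}\,\mathcal G$ and $\mathcal G\,\widetilde{\mid}\,\mathcal F$. For ultrafilters $\mathcal F,\mathcal G_n$, $\lim_{n\to\mathcal F}\mathcal G_n$ is the ultrafilter $\mathcal G$ such that for every $A\in\mathcal G$, $\{n\in N:A\in\mathcal G_n\}\in\mathcal F$. -}

module Defs where

open import Level using (0ℓ)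
open import Data.Nat using (ℕ)
open import Data.Nat.Divisibility using (_∣_)
open import Data.Product using (Σ; _×_; ∃)
open import Data.Sum using (_⊎_)
open import Data.Empty using (⊥)
open import Relation.Nullary using (¬_)
open import Relation.Unary using (Pred; _⊆_; _∩_; ∁; U; ∅)
open import Relation.Binary.PropositionalEquality using (_≡_)

Subset : Set₁
Subset = Pred ℕ 0ℓ

record Ultrafilter : Set₁ where
  field
    _∈F       : Subset → Set
    full      : U ∈F
    proper    : ¬ (∅ ∈F)
    upward    : ∀ {A B} → A ∈F → A ⊆ B → B ∈F
    inter     : ∀ {A B} → A ∈F → B ∈F → (A ∩ B) ∈F
    ultra     : ∀ A → A ∈F ⊎ (∁ A) ∈F
open Ultrafilter public

_∈ᵘ_ : Subset → Ultrafilter → Set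
A ∈ᵘ 𝓕 = _∈F 𝓕 A

_↑ : Subset → Subset
(A ↑) n = ∃ λ a → A a × a ∣ n

InU : Subset → Set
InU A = (A ↑) ⊆ A × A ⊆ (A ↑)

_~∣_ : Ultrafilter → Ultrafilter → Set₁
𝓕 ~∣ 𝓖 = ∀ (A : Subset) → A ∈ᵘ 𝓕 → InU A → A ∈ᵘ 𝓖

_=~_ : Ultrafilter → Ultrafilter → Set₁
𝓕 =~ 𝓖 = (𝓕 ~∣ 𝓖) × (𝓖 ~∣ 𝓕)

Nonprincipal : Ultrafilter → Set
Nonprincipal 𝓕 = ∀ (n : ℕ) → ¬ ((λ m → m ≡ n) ∈ᵘ 𝓕)

IsLim : Ultrafilter → (ℕ → Ultrafilter) → Ultrafilter → Set₁
IsLim 𝓕 Gs 𝓖 = ∀ (A : Subset) → A ∈ᵘ 𝓖 → (λ n → A ∈ᵘ Gs n) ∈ᵘ 𝓕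

-- A 𝓤-set in the limit 𝓖 lies in 𝓕-many 𝓖ₙ, hence in arbitrarily late 𝓖ₙ because 𝓕 is
-- nonprincipal, hence in every 𝓖ₙ because 𝓤-sets pass down the chain. Conversely a set
-- lying in every 𝓖ₙ lies in 𝓖, since otherwise its complement would lie in 𝓕-many 𝓖ₙ.
module Submission where

open import Defs
open import Data.Nat using (ℕ; suc; zero; _<_; _≤_; _≤′_; ≤′-refl; ≤′-step; s≤s)
open import Data.Nat.Properties using (≤⇒≤′; ≰⇒>; ≤∧≢⇒<)
open import Data.Product using (_×_; _,_; proj₁; proj₂)
open import Data.Sum using (inj₁; inj₂)
open import Relation.Nullary using (¬_; contradiction)
open import Relation.Unary using (∁)
open import Function.Base using (_∘_)
open import Function.Bundles using (_⇔_; mk⇔)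

module _ (𝓕 : Ultrafilter) where

  ∈ᵘ⇒∁∉ᵘ : ∀ {A} → A ∈ᵘ 𝓕 → ¬ (∁ A ∈ᵘ 𝓕)
  ∈ᵘ⇒∁∉ᵘ a c = proper 𝓕 (upward 𝓕 (inter 𝓕 a c) λ (x , ¬x) → ¬x x)

  ∁∉ᵘ⇒∈ᵘ : ∀ {A} → ¬ (∁ A ∈ᵘ 𝓕) → A ∈ᵘ 𝓕
  ∁∉ᵘ⇒∈ᵘ {A} ¬c with ultra 𝓕 A
  ... | inj₁ a = a
  ... | inj₂ c = contradiction c ¬c

  ∉ᵘ⇒∁∈ᵘ : ∀ {A} → ¬ (A ∈ᵘ 𝓕) → ∁ A ∈ᵘ 𝓕
  ∉ᵘ⇒∁∈ᵘ {A} ¬a with ultra 𝓕 A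
  ... | inj₁ a = contradiction a ¬a
  ... | inj₂ c = c

  module _ (nonprincipal : Nonprincipal 𝓕) where

    <-∉ᵘ : ∀ n → ¬ ((_< n) ∈ᵘ 𝓕)
    <-∉ᵘ zero    <0   = proper 𝓕 (upward 𝓕 <0 λ ())
    <-∉ᵘ (suc n) <1+n = <-∉ᵘ n (upward 𝓕 (inter 𝓕 <1+n (∉ᵘ⇒∁∈ᵘ (nonprincipal n)))
      λ { (s≤s m≤n , m≢n) → ≤∧≢⇒< m≤n m≢n })

    ≥-∈ᵘ : ∀ n → (n ≤_) ∈ᵘ 𝓕
    ≥-∈ᵘ n = ∁∉ᵘ⇒∈ᵘ λ ≱n → <-∉ᵘ n (upward 𝓕 ≱n ≰⇒>)

module _ (Gs : ℕ → Ultrafilter) where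

  ~∣-antitone : (∀ n → Gs (suc n) ~∣ Gs n) → ∀ {m n} → m ≤ n → Gs n ~∣ Gs m
  ~∣-antitone step m≤n = go (≤⇒≤′ m≤n)
    where
    go : ∀ {m n} → m ≤′ n → Gs n ~∣ Gs m
    go ≤′-refl            A a _ = a
    go (≤′-step {n} m≤′n) A a u = go m≤′n A (step n A a u) u

  IsLim-⋂⇒∈ : (𝓕 𝓖 : Ultrafilter) → IsLim 𝓕 Gs 𝓖 → ∀ {A} → (∀ n → A ∈ᵘ Gs n) → A ∈ᵘ 𝓖
  IsLim-⋂⇒∈ 𝓕 𝓖 lim {A} A∈Gs = ∁∉ᵘ⇒∈ᵘ 𝓖 λ c →
    proper 𝓕 (upward 𝓕 (lim (∁ A) c) λ {n} → ∈ᵘ⇒∁∉ᵘ (Gs n) (A∈Gs n))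

  IsLim-~∣ : (𝓕 𝓖 : Ultrafilter) → IsLim 𝓕 Gs 𝓖 →
    (𝓦 : Ultrafilter) → (∀ n → 𝓦 ~∣ Gs n) → 𝓦 ~∣ 𝓖
  IsLim-~∣ 𝓕 𝓖 lim 𝓦 𝓦~∣Gs A a u = IsLim-⋂⇒∈ 𝓕 𝓖 lim λ n → 𝓦~∣Gs n A a u

  IsLim-~∣-terms : (∀ n → Gs (suc n) ~∣ Gs n) →
    (𝓕 𝓖 : Ultrafilter) → Nonprincipal 𝓕 → IsLim 𝓕 Gs 𝓖 → ∀ n → 𝓖 ~∣ Gs n
  IsLim-~∣-terms step 𝓕 𝓖 nonprincipal lim n A a u = ∁∉ᵘ⇒∈ᵘ (Gs n) λ c →
    proper 𝓕 (upward 𝓕 (inter 𝓕 (lim A a) (≥-∈ᵘ 𝓕 nonprincipal n))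
      λ (A∈Gsm , n≤m) → ∈ᵘ⇒∁∉ᵘ (Gs n) (~∣-antitone step n≤m A A∈Gsm u) c)

lemma4p3 : (Gs : ℕ → Ultrafilter) → (∀ n → Gs (suc n) ~∣ Gs n) →
    ((𝓕 𝓖 : Ultrafilter) → Nonprincipal 𝓕 → IsLim 𝓕 Gs 𝓖 →
       ∀ (A : Subset) → (A ∈ᵘ 𝓖 × InU A) ⇔ (∀ n → A ∈ᵘ Gs n × InU A))
    × ((𝓕₁ 𝓕₂ 𝓖₁ 𝓖₂ : Ultrafilter) → Nonprincipal 𝓕₁ → Nonprincipal 𝓕₂ →
       IsLim 𝓕₁ Gs 𝓖₁ → IsLim 𝓕₂ Gs 𝓖₂ → 𝓖₁ =~ 𝓖₂)
    × ((𝓕 𝓖 : Ultrafilter) → Nonprincipal 𝓕 → IsLim 𝓕 Gs 𝓖 →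
       (𝓦 : Ultrafilter) → (∀ n → 𝓦 ~∣ Gs n) → 𝓦 ~∣ 𝓖)
lemma4p3 Gs step =
    (λ 𝓕 𝓖 nonprincipal lim A → mk⇔
      (λ (a , u) n → IsLim-~∣-terms Gs step 𝓕 𝓖 nonprincipal lim n A a u , u)
      (λ A∈Gs → IsLim-⋂⇒∈ Gs 𝓕 𝓖 lim (proj₁ ∘ A∈Gs) , proj₂ (A∈Gs 0)))
  , (λ 𝓕₁ 𝓕₂ 𝓖₁ 𝓖₂ nonprincipal₁ nonprincipal₂ lim₁ lim₂ →
        IsLim-~∣ Gs 𝓕₂ 𝓖₂ lim₂ 𝓖₁ (IsLim-~∣-terms Gs step 𝓕₁ 𝓖₁ nonprincipal₁ lim₁)
      , IsLim-~∣ Gs 𝓕₁ 𝓖₁ lim₁ 𝓖₂ (IsLim-~∣-terms Gs step 𝓕₂ 𝓖₂ nonprincipal₂ lim₂))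
  , (λ 𝓕 𝓖 _ → IsLim-~∣ Gs 𝓕 𝓖)
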